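{- For every history formula $\varphi$ of $\mathrm{CTL}^*\mathrm{K}\Delta$, every Kripke structure with observations $M$, every history $h$ of $M$ and every observation record $r$ that stops at $h$, \[ h,r\models\varphi \quad\text{iff}\quad \mathrm{last}(h),\mathit{IS}(h,r),o(h,r)\models_I\varphi. \]
   Context: Fix a countably infinite set $AP$ of atomic propositions and a finite set $\mathcal{O}$ of observations. History formulas $\varphi$ and path formulas $\psi$ of $\mathrm{CTL}^*\mathrm{K}\Delta$ are given by $\varphi::=p\mid\neg\varphi\mid\varphi\wedge\varphi\mid A\psi\mid K\varphi\mid\Delta^{o}\varphi$ and $\psi::=\varphi\mid\neg\psi\mid\psi\wedge\psi\mid X\psi\mid\psi U\psi$, with $p\in AP$, $o\in\mathcal{O}$. A Kripke structure with observations is $M=(AP_f,S,T,V,\{\sim_o\}_{o\in\mathcal{O}},s_{\mathrm{init}},o_{\mathrm{init}})$: $AP_f\subset AP$ finite, $S$ a set of states, $T\subseteq S\times S$ left-total, $V:S\to 2^{AP_f}$, each $\sim_o$ an equivalence relation on $S$, $s_{\mathrm{init}}\in S$, $o_{\mathrm{init}}\in\mathcal{O}$. Paths are infinite sequences $\pi=s_0s_1\dots$ with $s_iTs_{i+1}$; histories are finite nonempty prefixes of paths. For a word $w$: $|w|$ its length, $\mathrm{last}(w)$ its last letter, $w_i$ its $i$-th letter (from $0$), $w_{\le i}$ the prefix ending at position $i$, $w_{\ge i}$ the suffix starting at $i$; $w\preceq w'$ means prefix. $T(I)=\{s'\mid\exists s\in I, sTs'\}$, $[s]_o=\{s'\mid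 s\sim_o s'\}$. Observation records are finite words over $\mathcal{O}\times\mathbb{N}$; $r_{=n}$ is the subsequence of pairs of $r$ with second component $n$; $r$ stops at $n$ if $r_{=m}$ is empty for all $m>n$, and stops at $h$ if it stops at $|h|-1$; $\epsilon$ is the empty record. $\mathrm{ol}(r,0)=o_{\mathrm{init}}\cdot o_1\cdots o_k$ if $r_{=0}=(o_1,0)\cdots(o_k,0)$; $\mathrm{ol}(r,n+1)=\mathrm{last}(\mathrm{ol}(r,n))\cdot o_1\cdots o_k$ if $r_{=n+1}=(o_1,n+1)\cdots(o_k,n+1)$. $o(h,r)$ is the last element of $\mathrm{ol}(r,|h|-1)$. $h\sim_r h'$ iff $|h|=|h'|$ and $h_i\sim_o h'_i$ for all $i<|h|$ and $o\in\mathrm{ol}(r,i)$. Natural semantics: $h,r\models p$ iff $p\in V(\mathrm{last}(h))$; negation and conjunction as usual; $h,r\models A\psi$ iff for all paths $\pi$ with $h\preceq\pi$, $\pi,|h|-1,r\models\psi$; $h,r\models K\varphi$ iff for all $h'\sim_r h$, $h',r\models\varphi$; $h,r\models\Delta^o\varphi$ iff $h,r\cdot(o,|h|-1)\models\varphi$; $\pi,n,r\models\varphi$ iff $\pi_{\le n},r\models\varphi$; negation and conjunction as usual; $\pi,n,r\models X\psi$ iff $\pi,n+1,r\models\psi$; $\pi,n,r\models\psi_1U\psi_2$ iff there is $m\ge n$ with $\pi,m,r\models\psi_2$ and $\pi,k,r\models\psi_1$ for all $n\le k<m$. Information set: $\mathit{IS}(h,r)=\{s\mid\exists h'\sim_r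 h,\ \mathrm{last}(h')=s\}$. Updates: $U_T(I,s',o)=T(I)\cap[s']_o$, $U_\Delta(I,s,o')=I\cap[s]_{o'}$; $U_T^0(I,\pi,o)=I$, $U_T^{n+1}(I,\pi,o)=U_T(U_T^n(I,\pi,o),\pi_{n+1},o)$. Alternative semantics (state $s$, set $I\subseteq S$, observation $o$; path $\pi$): $s,I,o\models_I p$ iff $p\in V(s)$; negation and conjunction as usual; $s,I,o\models_I A\psi$ iff for all paths $\pi$ with $\pi_0=s$, $\pi,I,o\models_I\psi$; $s,I,o\models_I K\varphi$ iff for all $s'\in I$, $s',I,o\models_I\varphi$; $s,I,o\models_I\Delta^{o'}\varphi$ iff $s,U_\Delta(I,s,o'),o'\models_I\varphi$; $\pi,I,o\models_I\varphi$ iff $\pi_0,I,o\models_I\varphi$; negation and conjunction as usual; $\pi,I,o\models_I X\psi$ iff $\pi_{\ge1},U_T(I,\pi_1,o),o\models_I\psi$; $\pi,I,o\models_I\psi_1U\psi_2$ iff there is $n\ge0$ with $\pi_{\ge n},U_T^n(I,\pi,o),o\models_I\psi_2$ and for all $0\le m<n$, $\pi_{\ge m},U_T^m(I,\pi,o),o\models_I\psi_1$. -}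

module Defs where

open import Level using (0ℓ)
open import Data.Nat using (ℕ; zero; suc; _+_; _<_; _≤_)
open import Data.Nat.Properties using (_≟_)
open import Data.Fin using (Fin; toℕ)
open import Data.Bool using (Bool; true)
open import Data.Product using (Σ; ∃; _×_; _,_; proj₁; proj₂)
open import Data.List using (List; []; _++_; filter; map; [_])
open import Data.List.NonEmpty using (List⁺; _∷_; last; toList)
open import Data.List.Membership.Propositional using (_∈_)
open import Data.Vec using (Vec; lookup; tabulate)
import Data.Vec as Vec
open import Relation.Binary using (Rel; IsEquivalence)
open import Relation.Binary.PropositionalEquality using (_≡_)
open import Relation.Nullary using (¬_)

-- Atomic propositions: a countably infinite set, taken to be ℕ.
AP : Set
AP = ℕ

-- Observations: the finite set 𝒪 = Fin m.
-- History formulas (HForm) and path formulas (PForm) of CTL*KΔ.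
mutual
  data HForm (m : ℕ) : Set where
    atom : AP → HForm m
    neg  : HForm m → HForm m
    conj : HForm m → HForm m → HForm m
    A    : PForm m → HForm m
    K    : HForm m → HForm m
    Δ    : Fin m → HForm m → HForm m

  data PForm (m : ℕ) : Set where
    hist  : HForm m → PForm m
    pneg  : PForm m → PForm m
    pconj : PForm m → PForm m → PForm m
    X     : PForm m → PForm m
    U     : PForm m → PForm m → PForm m

-- Kripke structure with observations.
-- V s is a subset of AP_f, encoded by its characteristic function,
-- required to vanish outside AP_f.
record KSO (m : ℕ) : Set₁ where
  field
    APf       : List AP
    S         : Set
    T         : Rel S 0ℓ
    T-total   : ∀ s → ∃ λ s' → T s s'
    V         : S → AP → Bool
    V-in-APf  : ∀ s p → V s p ≡ true → p ∈ APf
    obs       : Fin m → Rel S 0ℓ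
    obs-equiv : ∀ o → IsEquivalence (obs o)
    sinit     : S
    oinit     : Fin m

ORec : ℕ → Set
ORec m = List (Fin m × ℕ)

_at=_ : ∀ {m} → ORec m → ℕ → ORec m
r at= n = filter (λ x → proj₂ x ≟ n) r

StopsAtN : ∀ {m} → ORec m → ℕ → Set
StopsAtN r n = ∀ k → n < k → r at= k ≡ []

-- ol(r, n), with o_init given explicitly
ol : ∀ {m} → Fin m → ORec m → ℕ → List⁺ (Fin m)
ol oi r zero    = oi ∷ map proj₁ (r at= 0)
ol oi r (suc n) = last (ol oi r n) ∷ map proj₁ (r at= suc n)

module _ {m : ℕ} (M : KSO m) where
  open KSO M

  -- a history of length suc n is a vector h of states
  IsPath : (ℕ → S) → Set
  IsPath π = ∀ i → T (π i) (π (suc i))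

  _⪯_ : ∀ {n} → Vec S (suc n) → (ℕ → S) → Set
  h ⪯ π = ∀ (i : Fin _) → lookup h i ≡ π (toℕ i)

  IsHistory : ∀ {n} → Vec S (suc n) → Set
  IsHistory h = ∃ λ π → IsPath π × h ⪯ π

  prefix : (ℕ → S) → (n : ℕ) → Vec S (suc n)
  prefix π n = tabulate (λ i → π (toℕ i))

  suffix : (ℕ → S) → ℕ → (ℕ → S)
  suffix π n i = π (n + i)

  StopsAt : ∀ {n} → ORec m → Vec S (suc n) → Set
  StopsAt {n} r h = StopsAtN r n

  oOf : ∀ {n} → Vec S (suc n) → ORec m → Fin m
  oOf {n} h r = last (ol oinit r n)

  _∼[_]_ : ∀ {n} → Vec S (suc n) → ORec m → Vec S (suc n) → Set
  h ∼[ r ] h' = ∀ (i : Fin _) (o : Fin m) → o ∈ toList (ol oinit r (toℕ i))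
                → obs o (lookup h i) (lookup h' i)

  mutual
    _,_⊨_ : ∀ {n} → Vec S (suc n) → ORec m → HForm m → Set
    h , r ⊨ atom p = V (Vec.last h) p ≡ true
    h , r ⊨ neg φ = ¬ (h , r ⊨ φ)
    h , r ⊨ conj φ₁ φ₂ = (h , r ⊨ φ₁) × (h , r ⊨ φ₂)
    _,_⊨_ {n} h r (A ψ) = ∀ π → IsPath π → h ⪯ π → π , n , r ⊨P ψ
    h , r ⊨ K φ = ∀ h' → IsHistory h' → h' ∼[ r ] h → h' , r ⊨ φ
    _,_⊨_ {n} h r (Δ o φ) = h , (r ++ [ (o , n) ]) ⊨ φ

    _,_,_⊨P_ : (ℕ → S) → ℕ → ORec m → PForm m → Set
    π , n , r ⊨P hist φ = prefix π n , r ⊨ φ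
    π , n , r ⊨P pneg ψ = ¬ (π , n , r ⊨P ψ)
    π , n , r ⊨P pconj ψ₁ ψ₂ = (π , n , r ⊨P ψ₁) × (π , n , r ⊨P ψ₂)
    π , n , r ⊨P X ψ = π , suc n , r ⊨P ψ
    π , n , r ⊨P U ψ₁ ψ₂ =
      ∃ λ k → n ≤ k × (π , k , r ⊨P ψ₂)
            × (∀ j → n ≤ j → j < k → π , j , r ⊨P ψ₁)

  IS : ∀ {n} → Vec S (suc n) → ORec m → S → Set
  IS {n} h r s = ∃ λ (h' : Vec S (suc n)) → IsHistory h' × h' ∼[ r ] h × Vec.last h' ≡ s

  cls : S → Fin m → S → Set
  cls s o s' = obs o s s'

  post : (S → Set) → S → Set
  post I s' = ∃ λ s → I s × T s s'

  UT : (S → Set) → S → Fin m → S → Set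
  UT I s' o s'' = post I s'' × cls s' o s''

  UΔ : (S → Set) → S → Fin m → S → Set
  UΔ I s o' s'' = I s'' × cls s o' s''

  UTⁿ : ℕ → (S → Set) → (ℕ → S) → Fin m → S → Set
  UTⁿ zero    I π o = I
  UTⁿ (suc n) I π o = UT (UTⁿ n I π o) (π (suc n)) o

  mutual
    _,_,_⊨I_ : S → (S → Set) → Fin m → HForm m → Set
    s , I , o ⊨I atom p = V s p ≡ true
    s , I , o ⊨I neg φ = ¬ (s , I , o ⊨I φ)
    s , I , o ⊨I conj φ₁ φ₂ = (s , I , o ⊨I φ₁) × (s , I , o ⊨I φ₂)
    s , I , o ⊨I A ψ = ∀ π → IsPath π → π 0 ≡ s → π , I , o ⊨IP ψ
    s , I , o ⊨I K φ = ∀ s' → I s' → s' , I , o ⊨I φ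
    s , I , o ⊨I Δ o' φ = s , UΔ I s o' , o' ⊨I φ

    _,_,_⊨IP_ : (ℕ → S) → (S → Set) → Fin m → PForm m → Set
    π , I , o ⊨IP hist φ = π 0 , I , o ⊨I φ
    π , I , o ⊨IP pneg ψ = ¬ (π , I , o ⊨IP ψ)
    π , I , o ⊨IP pconj ψ₁ ψ₂ = (π , I , o ⊨IP ψ₁) × (π , I , o ⊨IP ψ₂)
    π , I , o ⊨IP X ψ = suffix π 1 , UT I (π 1) o , o ⊨IP ψ
    π , I , o ⊨IP U ψ₁ ψ₂ =
      ∃ λ n → (suffix π n , UTⁿ n I π o , o ⊨IP ψ₂)
            × (∀ k → k < n → suffix π k , UTⁿ k I π o , o ⊨IP ψ₁)

-- The proof works with paths instead of histories: every history is the prefix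
-- π_{≤n} of a path π, and its information set IS(π_{≤n}, r) coincides with
-- ISᵖ r π n, the set of states π'(n) of paths π' that are indistinguishable from
-- π up to position n under the observations recorded in r.  Three facts about
-- ISᵖ carry the argument:
--   * for a record that stops at the current position, one step along π is
--     the update U_T with the current observation (ISᵖ-suc, ISᵖ-iterate);
--   * appending an observation (o, n) to r is the update U_Δ (ISᵖ-extend);
--   * ISᵖ only depends on π up to indistinguishability (ISᵖ-cong).
-- Since information sets are predicates, the alternative semantics is first
-- shown to be invariant under extensionally equal information sets and paths
-- (⊨I-cong).
module Submission where

open import Defs
open import Data.Nat using (ℕ; zero; suc; _+_; _<_; _≤_; s≤s)
open import Data.Vec using (Vec; last)
open import Level using (0ℓ)
open import Data.Nat.Properties
  using (≤-refl; <-irrefl; ≤-<-trans; n<1+n; m≤m+n; m≤n⇒m≤1+n; m≤n⇒m<n∨m≡n;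
         m≤n⇒∃[o]m+o≡n; +-monoʳ-<; +-cancelˡ-<; +-suc; +-identityʳ; +-assoc; +-comm)
import Data.Nat.Properties as ℕ
open import Data.Fin using (Fin; toℕ; fromℕ<)
open import Data.Fin.Properties using (toℕ-fromℕ<; toℕ≤pred[n])
open import Data.Product using (∃; _×_; _,_; proj₁; proj₂)
open import Data.Product.Function.NonDependent.Propositional using (_×-⇔_)
open import Data.Sum using (_⊎_; inj₁; inj₂)
open import Data.List using (List; []; _∷_; _++_; [_]; map; filter; initLast; _∷ʳ′_)
open import Data.List.Properties using (∷ʳ-injectiveʳ; filter-++; filter-accept; filter-reject; ++-identityʳ; map-++)
import Data.List.NonEmpty as List⁺
open import Data.List.NonEmpty using (toList)
open import Data.List.Membership.Propositional using (_∈_)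
open import Data.List.Membership.Propositional.Properties using (∈-++⁻; ∈-++⁺ˡ; ∈-++⁺ʳ)
open import Data.List.Relation.Unary.Any using (here)
import Data.Vec as Vec
open import Data.Vec.Properties using (lookup∘tabulate; tabulate∘lookup; tabulate-cong)
open import Data.Bool using (true)
open import Data.Empty using (⊥-elim)
open import Function using (_∘_; id)
open import Function.Bundles using (_⇔_; Equivalence; mk⇔)
open import Function.Properties.Equivalence using (⇔-setoid)
open import Function.Related.TypeIsomorphisms using (¬-cong-⇔)
open import Relation.Binary using (IsEquivalence)
open import Relation.Binary.PropositionalEquality
  using (_≡_; _≢_; _≗_; refl; sym; trans; cong; cong₂; subst; subst₂; module ≡-Reasoning)
open import Relation.Unary using (Pred; _≐_)
open import Relation.Unary.Properties using (≐-refl; ≐-sym; ≐-trans)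

import Relation.Binary.Reasoning.Setoid as SetoidReasoning

open Equivalence using (to; from)

module ⇔-Reasoning = SetoidReasoning (⇔-setoid 0ℓ)

last⁺-snoc : {E : Set} (x : E) (xs : List E) (y : E) → List⁺.last (x List⁺.∷ (xs ++ [ y ])) ≡ y
last⁺-snoc {E} x xs y = go (xs ++ [ y ]) refl
  where
  snoc≢[] : ∀ (zs : List E) → [] ≢ zs ++ [ y ]
  snoc≢[] [] ()
  snoc≢[] (_ ∷ _) ()
  go : (ys : List E) → ys ≡ xs ++ [ y ] → List⁺.last (x List⁺.∷ ys) ≡ y
  go ys eq with initLast ys
  go .[] eq | [] = ⊥-elim (snoc≢[] xs eq)
  go .(zs ++ [ z ]) eq | zs ∷ʳ′ z = ∷ʳ-injectiveʳ zs xs eq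

module Correspondence {m : ℕ} (M : KSO m) where
  open KSO M

  Sat : ∀ {n} → Vec S (suc n) → ORec m → HForm m → Set
  Sat = _,_⊨_ M

  SatP : (ℕ → S) → ℕ → ORec m → PForm m → Set
  SatP = _,_,_⊨P_ M

  SatI : S → Pred S 0ℓ → Fin m → HForm m → Set
  SatI = _,_,_⊨I_ M

  SatIP : (ℕ → S) → Pred S 0ℓ → Fin m → PForm m → Set
  SatIP = _,_,_⊨IP_ M

  Path : (ℕ → S) → Set
  Path = IsPath M

  prefixOf : (ℕ → S) → (n : ℕ) → Vec S (suc n)
  prefixOf = prefix M

  suffixOf : (ℕ → S) → ℕ → (ℕ → S)
  suffixOf = suffix M


  _≗[_]_ : (ℕ → S) → ℕ → (ℕ → S) → Set
  π ≗[ n ] π' = ∀ i → i ≤ n → π i ≡ π' i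

  lookup-prefix : ∀ π n (i : Fin (suc n)) → Vec.lookup (prefixOf π n) i ≡ π (toℕ i)
  lookup-prefix π n = lookup∘tabulate (π ∘ toℕ)

  last-prefix : ∀ π n → last (prefixOf π n) ≡ π n
  last-prefix π zero = refl
  last-prefix π (suc zero) = refl
  last-prefix π (suc (suc n)) = last-prefix (π ∘ suc) (suc n)

  prefix-⪯⇔agree : ∀ π n π' → _⪯_ M (prefixOf π n) π' ⇔ π ≗[ n ] π'
  prefix-⪯⇔agree π n π' = mk⇔ agree ⪯
    where
    agree : _⪯_ M (prefixOf π n) π' → π ≗[ n ] π'
    agree p i i≤n = subst (λ j → π j ≡ π' j) (toℕ-fromℕ< (s≤s i≤n))
                      (trans (sym (lookup-prefix π n i′)) (p i′))
      where i′ = fromℕ< (s≤s i≤n)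
    ⪯ : π ≗[ n ] π' → _⪯_ M (prefixOf π n) π'
    ⪯ a i = trans (lookup-prefix π n i) (a (toℕ i) (toℕ≤pred[n] i))

  prefix-⪯ : ∀ π n → _⪯_ M (prefixOf π n) π
  prefix-⪯ π n = from (prefix-⪯⇔agree π n π) (λ _ _ → refl)

  ⪯⇒≡prefix : ∀ {n} (h : Vec S (suc n)) π → _⪯_ M h π → h ≡ prefixOf π n
  ⪯⇒≡prefix h π p = trans (sym (tabulate∘lookup h)) (tabulate-cong p)

  suffix-path : ∀ π n → Path π → Path (suffixOf π n)
  suffix-path π n pp i = subst (λ j → T (π (n + i)) (π j)) (sym (+-suc n i)) (pp (n + i))

  suffix-suffix : ∀ π k e → suffixOf π (k + e) ≗ suffixOf (suffixOf π k) e
  suffix-suffix π k e i = cong π (+-assoc k e i)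

  graft : ℕ → (ℕ → S) → (ℕ → S) → ℕ → S
  graft n π π' zero = π 0
  graft zero π π' (suc i) = π' i
  graft (suc n) π π' (suc i) = graft n (π ∘ suc) π' i

  graft-agree : ∀ n π π' → graft n π π' ≗[ n ] π
  graft-agree n π π' zero _ = refl
  graft-agree (suc n) π π' (suc i) (s≤s i≤n) = graft-agree n (π ∘ suc) π' i i≤n

  graft-after : ∀ n π π' i → graft n π π' (suc n + i) ≡ π' i
  graft-after zero π π' i = refl
  graft-after (suc n) π π' i = graft-after n (π ∘ suc) π' i

  graft-path : ∀ n π π' → Path π → Path π' → T (π n) (π' 0) → Path (graft n π π')
  graft-path zero π π' pp pp' t zero = t
  graft-path zero π π' pp pp' t (suc i) = pp' i
  graft-path (suc n) π π' pp pp' t zero = pp 0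
  graft-path (suc n) π π' pp pp' t (suc i) = graft-path n (π ∘ suc) π' (pp ∘ suc) pp' t i

  -- Since T is left-total, every state starts a path.
  run : S → ℕ → S
  run s zero = s
  run s (suc i) = run (proj₁ (T-total s)) i

  run-path : ∀ s → Path (run s)
  run-path s zero = proj₂ (T-total s)
  run-path s (suc i) = run-path (proj₁ (T-total s)) i


  observed : ORec m → ℕ → List (Fin m)
  observed r i = toList (ol oinit r i)

  O : ORec m → ℕ → Fin m
  O r n = List⁺.last (ol oinit r n)

  stops-mono : ∀ (r : ORec m) {k j} → k ≤ j → StopsAtN r k → StopsAtN r j
  stops-mono r k≤j st i j<i = st i (≤-<-trans k≤j j<i)

  observed-quiet : ∀ r k → r at= suc k ≡ [] → ∀ {o} → o ∈ observed r (suc k) → o ≡ O r k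
  observed-quiet r k quiet {o} o∈ with r at= suc k | quiet | o∈
  ... | [] | refl | here o≡ = o≡

  O-quiet : ∀ r k → r at= suc k ≡ [] → O r (suc k) ≡ O r k
  O-quiet r k quiet = cong (λ l → List⁺.last (O r k List⁺.∷ map proj₁ l)) quiet

  O-stable : ∀ r k → StopsAtN r k → ∀ e → O r (k + e) ≡ O r k
  O-stable r k st zero = cong (O r) (+-identityʳ k)
  O-stable r k st (suc e) = begin
    O r (k + suc e)  ≡⟨ cong (O r) (+-suc k e) ⟩
    O r (suc (k + e)) ≡⟨ O-quiet r (k + e) (st (suc (k + e)) (s≤s (m≤m+n k e))) ⟩
    O r (k + e)       ≡⟨ O-stable r k st e ⟩
    O r k             ∎
    where open ≡-Reasoning

  extend : ORec m → Fin m → ℕ → ORec m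
  extend r o n = r ++ [ (o , n) ]

  extend-at-≢ : ∀ r o n k → k ≢ n → extend r o n at= k ≡ r at= k
  extend-at-≢ r o n k k≢n = begin
    filter P? (r ++ [ (o , n) ]) ≡⟨ filter-++ P? r [ (o , n) ] ⟩
    (r at= k) ++ filter P? [ (o , n) ] ≡⟨ cong ((r at= k) ++_) (filter-reject P? (k≢n ∘ sym)) ⟩
    (r at= k) ++ [] ≡⟨ ++-identityʳ _ ⟩
    r at= k ∎
    where
    open ≡-Reasoning
    P? = λ (x : Fin m × ℕ) → proj₂ x ℕ.≟ k

  extend-at-n : ∀ r o n → extend r o n at= n ≡ (r at= n) ++ [ (o , n) ]
  extend-at-n r o n = trans (filter-++ P? r [ (o , n) ]) (cong ((r at= n) ++_) (filter-accept P? refl))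
    where P? = λ (x : Fin m × ℕ) → proj₂ x ℕ.≟ n

  ol-extend-< : ∀ r o n i → i < n → ol oinit (extend r o n) i ≡ ol oinit r i
  ol-extend-< r o n zero 0<n =
    cong (λ l → oinit List⁺.∷ map proj₁ l) (extend-at-≢ r o n 0 (λ { refl → <-irrefl refl 0<n }))
  ol-extend-< r o n (suc i) i<n =
    cong₂ (λ a l → List⁺.last a List⁺.∷ map proj₁ l) (ol-extend-< r o n i (ℕ.<-trans (n<1+n i) i<n))
      (extend-at-≢ r o n (suc i) (λ { refl → <-irrefl refl i<n }))

  entry : ORec m → ℕ → Fin m
  entry r zero = oinit
  entry r (suc n) = O r n

  ol-shape : ∀ r n → ol oinit r n ≡ entry r n List⁺.∷ map proj₁ (r at= n)
  ol-shape r zero = refl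
  ol-shape r (suc n) = refl

  entry-extend : ∀ r o n → entry (extend r o n) n ≡ entry r n
  entry-extend r o zero = refl
  entry-extend r o (suc n) = cong List⁺.last (ol-extend-< r o (suc n) n (n<1+n n))

  ol-extend-n : ∀ r o n → ol oinit (extend r o n) n ≡ entry r n List⁺.∷ (map proj₁ (r at= n) ++ [ o ])
  ol-extend-n r o n = trans (ol-shape (extend r o n) n) (cong₂ List⁺._∷_ (entry-extend r o n) recorded)
    where
    recorded : map proj₁ (extend r o n at= n) ≡ map proj₁ (r at= n) ++ [ o ]
    recorded = trans (cong (map proj₁) (extend-at-n r o n)) (map-++ proj₁ (r at= n) [ (o , n) ])

  observed-extend-n : ∀ r o n → observed (extend r o n) n ≡ observed r n ++ [ o ]
  observed-extend-n r o n =
    trans (cong toList (ol-extend-n r o n)) (cong (λ l → toList l ++ [ o ]) (sym (ol-shape r n)))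

  O-extend : ∀ r o n → O (extend r o n) n ≡ o
  O-extend r o n = trans (cong List⁺.last (ol-extend-n r o n)) (last⁺-snoc (entry r n) (map proj₁ (r at= n)) o)

  stops-extend : ∀ r o n → StopsAtN r n → StopsAtN (extend r o n) n
  stops-extend r o n st k n<k = trans (extend-at-≢ r o n k (λ { refl → <-irrefl refl n<k })) (st k n<k)


  _≈[_,_]_ : (ℕ → S) → ORec m → ℕ → (ℕ → S) → Set
  π ≈[ r , n ] π' = ∀ i → i ≤ n → ∀ o → o ∈ observed r i → obs o (π i) (π' i)

  ≈-sym : ∀ {π π' r n} → π ≈[ r , n ] π' → π' ≈[ r , n ] π
  ≈-sym R i i≤n o o∈ = IsEquivalence.sym (obs-equiv o) (R i i≤n o o∈)

  ≈-trans : ∀ {π π' π'' r n} → π ≈[ r , n ] π' → π' ≈[ r , n ] π'' → π ≈[ r , n ] π''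
  ≈-trans R R' i i≤n o o∈ = IsEquivalence.trans (obs-equiv o) (R i i≤n o o∈) (R' i i≤n o o∈)

  agree⇒≈ : ∀ {π π' r n} → π ≗[ n ] π' → π ≈[ r , n ] π'
  agree⇒≈ {π} a i i≤n o _ = subst (obs o (π i)) (a i i≤n) (IsEquivalence.refl (obs-equiv o))

  prefix-∼⇔≈ : ∀ r n π' π → _∼[_]_ M (prefixOf π' n) r (prefixOf π n) ⇔ π' ≈[ r , n ] π
  prefix-∼⇔≈ r n π' π = mk⇔ ≈ ∼
    where
    ≈ : _∼[_]_ M (prefixOf π' n) r (prefixOf π n) → π' ≈[ r , n ] π
    ≈ rel i i≤n o o∈ =
      subst (λ j → obs o (π' j) (π j)) i′≡i
        (subst₂ (obs o) (lookup-prefix π' n i′) (lookup-prefix π n i′)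
          (rel i′ o (subst (λ j → o ∈ observed r j) (sym i′≡i) o∈)))
      where
      i′ = fromℕ< (s≤s i≤n)
      i′≡i = toℕ-fromℕ< (s≤s i≤n)
    ∼ : π' ≈[ r , n ] π → _∼[_]_ M (prefixOf π' n) r (prefixOf π n)
    ∼ R i o o∈ = subst₂ (obs o) (sym (lookup-prefix π' n i)) (sym (lookup-prefix π n i))
                   (R (toℕ i) (toℕ≤pred[n] i) o o∈)

  -- The information set of π_{≤n}, described through paths.
  ISᵖ : ORec m → (ℕ → S) → ℕ → Pred S 0ℓ
  ISᵖ r π n s = ∃ λ π' → Path π' × π' ≈[ r , n ] π × π' n ≡ s

  IS≐ISᵖ : ∀ r π n → IS M (prefixOf π n) r ≐ ISᵖ r π n
  IS≐ISᵖ r π n = ⊆ᵖ , ⊇ᵖ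
    where
    ⊆ᵖ : ∀ {s} → IS M (prefixOf π n) r s → ISᵖ r π n s
    ⊆ᵖ (h' , (π' , pp' , h'⪯π') , rel , last≡s) with ⪯⇒≡prefix h' π' h'⪯π'
    ... | refl = π' , pp' , to (prefix-∼⇔≈ r n π' π) rel , trans (sym (last-prefix π' n)) last≡s
    ⊇ᵖ : ∀ {s} → ISᵖ r π n s → IS M (prefixOf π n) r s
    ⊇ᵖ (π' , pp' , R , π'n≡s) =
      prefixOf π' n , (π' , pp' , prefix-⪯ π' n) , from (prefix-∼⇔≈ r n π' π) R ,
      trans (last-prefix π' n) π'n≡s

  ISᵖ-cong : ∀ {r n π π'} → π ≈[ r , n ] π' → ISᵖ r π n ≐ ISᵖ r π' n
  ISᵖ-cong R = (λ { (π'' , pp , R' , e) → π'' , pp , ≈-trans R' R , e })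
             , (λ { (π'' , pp , R' , e) → π'' , pp , ≈-trans R' (≈-sym R) , e })

  -- One step along π without new records is the update U_T with the current
  -- observation.  For ⊇, a witness path is extended beyond s by `run s`.
  ISᵖ-suc : ∀ r π k → r at= suc k ≡ [] → ISᵖ r π (suc k) ≐ UT M (ISᵖ r π k) (π (suc k)) (O r k)
  ISᵖ-suc r π k quiet = ⊆ᵘ , ⊇ᵘ
    where
    in-force : O r k ∈ observed r (suc k)
    in-force = here refl
    ⊆ᵘ : ∀ {s} → ISᵖ r π (suc k) s → UT M (ISᵖ r π k) (π (suc k)) (O r k) s
    ⊆ᵘ (π' , pp , R , refl) =
      (π' k , (π' , pp , (λ i i≤k → R i (m≤n⇒m≤1+n i≤k)) , refl) , pp k) ,
      IsEquivalence.sym (obs-equiv (O r k)) (R (suc k) ≤-refl (O r k) in-force)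
    ⊇ᵘ : ∀ {s} → UT M (ISᵖ r π k) (π (suc k)) (O r k) s → ISᵖ r π (suc k) s
    ⊇ᵘ {s} ((_ , (π' , pp , R , refl) , t) , obs-s) = π'' , pp'' , R'' , ends-in-s
      where
      π'' = graft k π' (run s)
      pp'' = graft-path k π' (run s) pp (run-path s) t
      ends-in-s : π'' (suc k) ≡ s
      ends-in-s = trans (cong π'' (sym (+-identityʳ (suc k)))) (graft-after k π' (run s) 0)
      R'' : π'' ≈[ r , suc k ] π
      R'' i i≤ o o∈ with m≤n⇒m<n∨m≡n i≤
      ... | inj₁ (s≤s i≤k) =
        subst (λ x → obs o x (π i)) (sym (graft-agree k π' (run s) i i≤k)) (R i i≤k o o∈)
      ... | inj₂ refl with observed-quiet r k quiet o∈
      ...   | refl = subst (λ x → obs o x (π (suc k))) (sym ends-in-s)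
                       (IsEquivalence.sym (obs-equiv o) obs-s)

  UT-cong : ∀ {I J s o} → I ≐ J → UT M I s o ≐ UT M J s o
  UT-cong (I⊆J , J⊆I) = (λ { ((s₀ , i , t) , c) → (s₀ , I⊆J i , t) , c })
                      , (λ { ((s₀ , j , t) , c) → (s₀ , J⊆I j , t) , c })

  ISᵖ-iterate : ∀ r π k → StopsAtN r k → ∀ e →
                UTⁿ M e (ISᵖ r π k) (suffixOf π k) (O r k) ≐ ISᵖ r π (k + e)
  ISᵖ-iterate r π k st zero rewrite +-identityʳ k = ≐-refl
  ISᵖ-iterate r π k st (suc e) rewrite +-suc k e =
    ≐-trans (UT-cong (ISᵖ-iterate r π k st e)) (≐-sym step)
    where
    step : ISᵖ r π (suc (k + e)) ≐ UT M (ISᵖ r π (k + e)) (π (suc (k + e))) (O r k)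
    step = subst (λ o → ISᵖ r π (suc (k + e)) ≐ UT M (ISᵖ r π (k + e)) (π (suc (k + e))) o)
             (O-stable r k st e)
             (ISᵖ-suc r π (k + e) (st (suc (k + e)) (s≤s (m≤m+n k e))))

  ISᵖ-extend : ∀ r o π n → ISᵖ (extend r o n) π n ≐ UΔ M (ISᵖ r π n) (π n) o
  ISᵖ-extend r o π n = ⊆ᵈ , ⊇ᵈ
    where
    r⁺ = extend r o n
    old-in-force : ∀ {o'} i → i ≤ n → o' ∈ observed r i → o' ∈ observed r⁺ i
    old-in-force {o'} i i≤n o'∈ with m≤n⇒m<n∨m≡n i≤n
    ... | inj₁ i<n = subst (λ l → o' ∈ toList l) (sym (ol-extend-< r o n i i<n)) o'∈
    ... | inj₂ refl = subst (o' ∈_) (sym (observed-extend-n r o n)) (∈-++⁺ˡ o'∈)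
    new-in-force : ∀ {o'} i → i ≤ n → o' ∈ observed r⁺ i → o' ∈ observed r i ⊎ (i ≡ n × o' ≡ o)
    new-in-force {o'} i i≤n o'∈ with m≤n⇒m<n∨m≡n i≤n
    ... | inj₁ i<n = inj₁ (subst (λ l → o' ∈ toList l) (ol-extend-< r o n i i<n) o'∈)
    ... | inj₂ refl with ∈-++⁻ (observed r n) (subst (o' ∈_) (observed-extend-n r o n) o'∈)
    ...   | inj₁ old = inj₁ old
    ...   | inj₂ (here o'≡o) = inj₂ (refl , o'≡o)
    o-in-force : o ∈ observed r⁺ n
    o-in-force = subst (o ∈_) (sym (observed-extend-n r o n)) (∈-++⁺ʳ (observed r n) (here refl))
    ⊆ᵈ : ∀ {s} → ISᵖ r⁺ π n s → UΔ M (ISᵖ r π n) (π n) o s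
    ⊆ᵈ (π' , pp , R , refl) =
      (π' , pp , (λ i i≤n o' o'∈ → R i i≤n o' (old-in-force i i≤n o'∈)) , refl) ,
      IsEquivalence.sym (obs-equiv o) (R n ≤-refl o o-in-force)
    ⊇ᵈ : ∀ {s} → UΔ M (ISᵖ r π n) (π n) o s → ISᵖ r⁺ π n s
    ⊇ᵈ ((π' , pp , R , refl) , obs-s) = π' , pp , R⁺ , refl
      where
      R⁺ : π' ≈[ r⁺ , n ] π
      R⁺ i i≤n o' o'∈ with new-in-force i i≤n o'∈
      ... | inj₁ old = R i i≤n o' old
      ... | inj₂ (refl , refl) = IsEquivalence.sym (obs-equiv o) obs-s


  -- The alternative semantics only sees I up to ≐ and π pointwise; this is
  -- needed because the information sets computed by U_T are predicates that
  -- agree with ISᵖ only extensionally.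
  UTⁿ-cong : ∀ e {I J π π' o} → I ≐ J → π ≗ π' → UTⁿ M e I π o ≐ UTⁿ M e J π' o
  UTⁿ-cong zero I≐J _ = I≐J
  UTⁿ-cong (suc e) I≐J π≗π' rewrite π≗π' (suc e) = UT-cong (UTⁿ-cong e I≐J π≗π')

  mutual
    ⊨I-cong : ∀ φ {s I J o} → I ≐ J → SatI s I o φ ⇔ SatI s J o φ
    ⊨I-cong (atom p) _ = mk⇔ id id
    ⊨I-cong (neg φ) I≐J = ¬-cong-⇔ (⊨I-cong φ I≐J)
    ⊨I-cong (conj φ₁ φ₂) I≐J = ⊨I-cong φ₁ I≐J ×-⇔ ⊨I-cong φ₂ I≐J
    ⊨I-cong (A ψ) I≐J = mk⇔ (λ f π pp π₀ → to (same π) (f π pp π₀)) (λ g π pp π₀ → from (same π) (g π pp π₀))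
      where same = λ π → ⊨IP-cong ψ {π} (λ _ → refl) I≐J
    ⊨I-cong (K φ) I≐J@(I⊆J , J⊆I) =
      mk⇔ (λ f s j → to (⊨I-cong φ I≐J) (f s (J⊆I j))) (λ g s i → from (⊨I-cong φ I≐J) (g s (I⊆J i)))
    ⊨I-cong (Δ o φ) (I⊆J , J⊆I) =
      ⊨I-cong φ ((λ { (i , c) → I⊆J i , c }) , (λ { (j , c) → J⊆I j , c }))

    ⊨IP-cong : ∀ ψ {π π' I J o} → π ≗ π' → I ≐ J → SatIP π I o ψ ⇔ SatIP π' J o ψ
    ⊨IP-cong (hist φ) {π} {π'} {I} {J} {o} π≗π' I≐J =
      subst (λ s → SatI (π 0) I o φ ⇔ SatI s J o φ) (π≗π' 0) (⊨I-cong φ I≐J)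
    ⊨IP-cong (pneg ψ) π≗π' I≐J = ¬-cong-⇔ (⊨IP-cong ψ π≗π' I≐J)
    ⊨IP-cong (pconj ψ₁ ψ₂) π≗π' I≐J = ⊨IP-cong ψ₁ π≗π' I≐J ×-⇔ ⊨IP-cong ψ₂ π≗π' I≐J
    ⊨IP-cong (X ψ) π≗π' I≐J = ⊨IP-cong ψ (π≗π' ∘ suc) (UTⁿ-cong 1 I≐J π≗π')
    ⊨IP-cong (U ψ₁ ψ₂) π≗π' I≐J =
      mk⇔ (λ { (n , s₂ , s₁) → n , to (after n ψ₂) s₂ , (λ k k<n → to (after k ψ₁) (s₁ k k<n)) })
          (λ { (n , s₂ , s₁) → n , from (after n ψ₂) s₂ , (λ k k<n → from (after k ψ₁) (s₁ k k<n)) })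
      where after = λ n ψ → ⊨IP-cong ψ (λ i → π≗π' (n + i)) (UTⁿ-cong n I≐J π≗π')


  HistoryCorrespondence : HForm m → ORec m → ℕ → (ℕ → S) → Set
  HistoryCorrespondence φ r n π = Sat (prefixOf π n) r φ ⇔ SatI (π n) (ISᵖ r π n) (O r n) φ

  PathCorrespondence : PForm m → ORec m → ℕ → (ℕ → S) → Set
  PathCorrespondence ψ r k π = SatP π k r ψ ⇔ SatIP (suffixOf π k) (ISᵖ r π k) (O r k) ψ

  -- The claim at position k + e, phrased through e updates U_T from position k:
  -- this is the form in which X and U unfold in the alternative semantics.
  ShiftedCorrespondence : PForm m → ORec m → ℕ → (ℕ → S) → ℕ → Set
  ShiftedCorrespondence ψ r k π e =
    SatP π (k + e) r ψ ⇔ SatIP (suffixOf (suffixOf π k) e) (UTⁿ M e (ISᵖ r π k) (suffixOf π k) (O r k)) (O r k) ψ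

  -- A correspondence at position k + e yields the shifted one, since the record
  -- keeps its observation from k on and e updates U_T compute ISᵖ r π (k + e).
  shift : ∀ ψ r π k → StopsAtN r k → ∀ e → PathCorrespondence ψ r (k + e) π → ShiftedCorrespondence ψ r k π e
  shift ψ r π k st e corr = begin
    SatP π (k + e) r ψ
      ≈⟨ corr ⟩
    SatIP (suffixOf π (k + e)) (ISᵖ r π (k + e)) (O r (k + e)) ψ
      ≡⟨ cong (λ o → SatIP (suffixOf π (k + e)) (ISᵖ r π (k + e)) o ψ) (O-stable r k st e) ⟩
    SatIP (suffixOf π (k + e)) (ISᵖ r π (k + e)) (O r k) ψ
      ≈⟨ ⊨IP-cong ψ (suffix-suffix π k e) (≐-sym (ISᵖ-iterate r π k st e)) ⟩
    SatIP (suffixOf (suffixOf π k) e) (UTⁿ M e (ISᵖ r π k) (suffixOf π k) (O r k)) (O r k) ψ ∎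
    where open ⇔-Reasoning

  atom-step : ∀ p r n π → HistoryCorrespondence (atom p) r n π
  atom-step p r n π = begin
    V (last (prefixOf π n)) p ≡ true ≡⟨ cong (λ s → V s p ≡ true) (last-prefix π n) ⟩
    V (π n) p ≡ true ∎
    where open ⇔-Reasoning

  -- K: the histories ∼_r-related to π_{≤n} are the prefixes of the paths
  -- indistinguishable from π, whose last states form ISᵖ r π n.
  K-step : ∀ φ r n → (∀ π → Path π → HistoryCorrespondence φ r n π) →
           ∀ π₀ → HistoryCorrespondence (K φ) r n π₀
  K-step φ r n corr π₀ = mk⇔ ⇒ ⇐
    where
    ⇒ : Sat (prefixOf π₀ n) r (K φ) → SatI (π₀ n) (ISᵖ r π₀ n) (O r n) (K φ)
    ⇒ f _ (π , pp , R , refl) =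
      to (⊨I-cong φ (ISᵖ-cong R))
        (to (corr π pp) (f (prefixOf π n) (π , pp , prefix-⪯ π n) (from (prefix-∼⇔≈ r n π π₀) R)))
    ⇐ : SatI (π₀ n) (ISᵖ r π₀ n) (O r n) (K φ) → Sat (prefixOf π₀ n) r (K φ)
    ⇐ g h (π , pp , h⪯π) h∼ with ⪯⇒≡prefix h π h⪯π
    ... | refl = from (corr π pp) (from (⊨I-cong φ (ISᵖ-cong R)) (g (π n) (π , pp , R , refl)))
      where R = to (prefix-∼⇔≈ r n π π₀) h∼

  -- A: the paths extending π₀_{≤n} correspond to the paths from π₀(n), by
  -- taking suffixes in one direction and grafting onto π₀ in the other.
  A-step : ∀ ψ r n → (∀ π → Path π → PathCorrespondence ψ r n π) →
           ∀ π₀ → Path π₀ → HistoryCorrespondence (A ψ) r n π₀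
  A-step ψ r n corr π₀ pp₀ = mk⇔ ⇒ ⇐
    where
    ⇒ : Sat (prefixOf π₀ n) r (A ψ) → SatI (π₀ n) (ISᵖ r π₀ n) (O r n) (A ψ)
    ⇒ f π' pp' starts = to (⊨IP-cong ψ continues (ISᵖ-cong (agree⇒≈ agree))) (to (corr π pp) sat)
      where
      π = graft n π₀ (suffixOf π' 1)
      pp = graft-path n π₀ (suffixOf π' 1) pp₀ (suffix-path π' 1 pp') (subst (λ s → T s (π' 1)) starts (pp' 0))
      agree = graft-agree n π₀ (suffixOf π' 1)
      sat : SatP π n r ψ
      sat = f π pp (from (prefix-⪯⇔agree π₀ n π) (λ i i≤n → sym (agree i i≤n)))
      continues : suffixOf π n ≗ π'
      continues zero = trans (cong π (+-identityʳ n)) (trans (agree n ≤-refl) (sym starts))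
      continues (suc i) = trans (cong π (+-suc n i)) (graft-after n π₀ (suffixOf π' 1) i)
    ⇐ : SatI (π₀ n) (ISᵖ r π₀ n) (O r n) (A ψ) → Sat (prefixOf π₀ n) r (A ψ)
    ⇐ g π pp π₀⪯π = from (corr π pp) (from (⊨IP-cong ψ (λ _ → refl) (ISᵖ-cong R)) (g (suffixOf π n) (suffix-path π n pp) starts))
      where
      agree = to (prefix-⪯⇔agree π₀ n π) π₀⪯π
      R : π ≈[ r , n ] π₀
      R = agree⇒≈ (λ i i≤n → sym (agree i i≤n))
      starts : suffixOf π n 0 ≡ π₀ n
      starts = trans (cong π (+-identityʳ n)) (sym (agree n ≤-refl))

  -- Δ^o: recording o turns ISᵖ into its U_Δ-update and makes o current.
  Δ-step : ∀ φ r o n π → HistoryCorrespondence φ (extend r o n) n π → HistoryCorrespondence (Δ o φ) r n π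
  Δ-step φ r o n π corr = begin
    Sat (prefixOf π n) (extend r o n) φ
      ≈⟨ corr ⟩
    SatI (π n) (ISᵖ (extend r o n) π n) (O (extend r o n) n) φ
      ≡⟨ cong (λ o' → SatI (π n) (ISᵖ (extend r o n) π n) o' φ) (O-extend r o n) ⟩
    SatI (π n) (ISᵖ (extend r o n) π n) o φ
      ≈⟨ ⊨I-cong φ (ISᵖ-extend r o π n) ⟩
    SatI (π n) (UΔ M (ISᵖ r π n) (π n) o) o φ ∎
    where open ⇔-Reasoning

  hist-step : ∀ φ r k π → HistoryCorrespondence φ r k π → PathCorrespondence (hist φ) r k π
  hist-step φ r k π corr = begin
    Sat (prefixOf π k) r φ ≈⟨ corr ⟩
    SatI (π k) (ISᵖ r π k) (O r k) φ ≡⟨ cong (λ s → SatI s (ISᵖ r π k) (O r k) φ) (cong π (sym (+-identityʳ k))) ⟩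
    SatI (π (k + 0)) (ISᵖ r π k) (O r k) φ ∎
    where open ⇔-Reasoning

  X-step : ∀ ψ r k π → ShiftedCorrespondence ψ r k π 1 → PathCorrespondence (X ψ) r k π
  X-step ψ r k π corr = begin
    SatP π (suc k) r ψ ≡⟨ cong (λ j → SatP π j r ψ) (+-comm 1 k) ⟩
    SatP π (k + 1) r ψ ≈⟨ corr ⟩
    SatIP (suffixOf π k) (ISᵖ r π k) (O r k) (X ψ) ∎
    where open ⇔-Reasoning

  -- U: a witness position j ≥ k of the natural semantics is k + e for the
  -- witness e of the alternative semantics.
  U-step : ∀ ψ₁ ψ₂ r k π → (∀ e → ShiftedCorrespondence ψ₁ r k π e) → (∀ e → ShiftedCorrespondence ψ₂ r k π e) →
           PathCorrespondence (U ψ₁ ψ₂) r k π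
  U-step ψ₁ ψ₂ r k π corr₁ corr₂ = mk⇔ ⇒ ⇐
    where
    ⇒ : SatP π k r (U ψ₁ ψ₂) → SatIP (suffixOf π k) (ISᵖ r π k) (O r k) (U ψ₁ ψ₂)
    ⇒ (j , k≤j , sat₂ , sat₁) with m≤n⇒∃[o]m+o≡n k≤j
    ... | e , refl = e , to (corr₂ e) sat₂ , λ d d<e → to (corr₁ d) (sat₁ (k + d) (m≤m+n k d) (+-monoʳ-< k d<e))
    ⇐ : SatIP (suffixOf π k) (ISᵖ r π k) (O r k) (U ψ₁ ψ₂) → SatP π k r (U ψ₁ ψ₂)
    ⇐ (e , sat₂ , sat₁) = k + e , m≤m+n k e , from (corr₂ e) sat₂ , before
      where
      before : ∀ j → k ≤ j → j < k + e → SatP π j r ψ₁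
      before j k≤j j<k+e with m≤n⇒∃[o]m+o≡n k≤j
      ... | d , refl = from (corr₁ d) (sat₁ d (+-cancelˡ-< k d e j<k+e))


  mutual
    history-correspondence : ∀ φ r n π → Path π → StopsAtN r n → HistoryCorrespondence φ r n π
    history-correspondence (atom p) r n π pp st = atom-step p r n π
    history-correspondence (neg φ) r n π pp st = ¬-cong-⇔ (history-correspondence φ r n π pp st)
    history-correspondence (conj φ₁ φ₂) r n π pp st =
      history-correspondence φ₁ r n π pp st ×-⇔ history-correspondence φ₂ r n π pp st
    history-correspondence (A ψ) r n π pp st =
      A-step ψ r n (λ π' pp' → path-correspondence ψ r n π' pp' st) π pp
    history-correspondence (K φ) r n π pp st =
      K-step φ r n (λ π' pp' → history-correspondence φ r n π' pp' st) π
    history-correspondence (Δ o φ) r n π pp st =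
      Δ-step φ r o n π (history-correspondence φ (extend r o n) n π pp (stops-extend r o n st))

    path-correspondence : ∀ ψ r k π → Path π → StopsAtN r k → PathCorrespondence ψ r k π
    path-correspondence (hist φ) r k π pp st = hist-step φ r k π (history-correspondence φ r k π pp st)
    path-correspondence (pneg ψ) r k π pp st = ¬-cong-⇔ (path-correspondence ψ r k π pp st)
    path-correspondence (pconj ψ₁ ψ₂) r k π pp st =
      path-correspondence ψ₁ r k π pp st ×-⇔ path-correspondence ψ₂ r k π pp st
    path-correspondence (X ψ) r k π pp st = X-step ψ r k π (shifted-correspondence ψ r k π pp st 1)
    path-correspondence (U ψ₁ ψ₂) r k π pp st =
      U-step ψ₁ ψ₂ r k π (shifted-correspondence ψ₁ r k π pp st) (shifted-correspondence ψ₂ r k π pp st)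

    shifted-correspondence : ∀ ψ r k π → Path π → StopsAtN r k → ∀ e → ShiftedCorrespondence ψ r k π e
    shifted-correspondence ψ r k π pp st e =
      shift ψ r π k st e (path-correspondence ψ r (k + e) π pp (stops-mono r (m≤m+n k e) st))

-- Every history is the prefix of a path, and its information set IS is ISᵖ.
theorem17 : ∀ (m : ℕ) (M : KSO m) (φ : HForm m) (n : ℕ) (h : Vec (KSO.S M) (suc n))
            → IsHistory M h → (r : ORec m) → StopsAt M r h
            → (_,_⊨_ M h r φ) ⇔ (_,_,_⊨I_ M (last h) (IS M h r) (oOf M h r) φ)
theorem17 m M φ n h (π , pp , h⪯π) r st with Correspondence.⪯⇒≡prefix M h π h⪯π
... | refl = begin
  Sat (prefixOf π n) r φ                                    ≈⟨ history-correspondence φ r n π pp st ⟩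
  SatI (π n) (ISᵖ r π n) (O r n) φ                          ≈⟨ ⊨I-cong φ (≐-sym (IS≐ISᵖ r π n)) ⟩
  SatI (π n) (IS M (prefixOf π n) r) (O r n) φ              ≡⟨ cong (λ s → SatI s (IS M (prefixOf π n) r) (O r n) φ) (sym (last-prefix π n)) ⟩
  SatI (last (prefixOf π n)) (IS M (prefixOf π n) r) (O r n) φ ∎
  where
  open Correspondence M
  open ⇔-Reasoning
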